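{- Let $n\ge 1$ be an integer. There is a bijection between the set of $3$-compositions of $n$ and the set of ordered pairs $(A,B)$ of integer compositions of $n$.
   Context: An integer composition of $n$ is a finite tuple $(n_1,\dots,n_k)$ of positive integers with $n_1+\dots+n_k=n$. A $3$-composition of $n$ is an integer composition $(n_1,\dots,n_k)$ of $n$ in which each part $n_i$ is additionally assigned one of three colors $1,2,3$, subject to the restriction that the last part $n_k$ has color $1$; two $3$-compositions are equal if they have the same parts in the same order with the same colors. -}

module Defs where

open import Data.Nat using (ℕ; suc)
open import Data.Fin using (Fin; zero)
open import Data.List using (List; []; _∷_; map)
open import Data.Nat.ListAction using (sum)
open import Data.Product using (Σ; _×_; _,_; proj₁)
open import Relation.Binary.PropositionalEquality using (_≡_)

-- A part is represented as a natural number k, standing for the positive part suc k.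
-- An integer composition of n: a list of positive parts summing to n.
Composition : ℕ → Set
Composition n = Σ (List ℕ) (λ ks → sum (map suc ks) ≡ n)

-- A coloured part: (k , c) stands for the part suc k with colour c ∈ {1,2,3}
-- (Fin 3 : zero = colour 1, suc zero = colour 2, suc (suc zero) = colour 3).
ColouredPart : Set
ColouredPart = ℕ × Fin 3

data LastColourOne : List ColouredPart → Set where
  last-[] : LastColourOne []
  last-one : ∀ k → LastColourOne ((k , zero) ∷ [])
  last-cons : ∀ p q ps → LastColourOne (q ∷ ps) → LastColourOne (p ∷ q ∷ ps)

ThreeComposition : ℕ → Set
ThreeComposition n =
  Σ (List ColouredPart)
    (λ ps → (sum (map (λ p → suc (proj₁ p)) ps) ≡ n) × LastColourOne ps)

-- Cutting n into parts means deciding, at each of the n − 1 gaps between consecutive units,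
-- whether to cut there. In a 3-composition every cut also records the colour of the part it
-- closes, while the colour of the last part is forced. So 3-compositions of n are the words of
-- length n − 1 over the four letters {no cut, cut of colour 1, 2, 3}, and compositions of n the
-- words over {no cut, cut}. Reading colour 1 as a cut in both compositions and colours 2 and 3
-- as a cut in only the first or only the second splits a four-letter word into two binary ones.
module Submission where

open import Defs
open import Axiom.UniquenessOfIdentityProofs.WithK using (uip)
open import Data.Fin using (Fin; zero; suc)
open import Data.List using (List; []; _∷_; map)
open import Data.List.NonEmpty as List⁺ using (List⁺; _∷_; _∷⁺_; toList)
open import Data.Maybe using (Maybe; nothing; just)
open import Data.Nat using (ℕ; zero; suc; _+_; _≥_)
open import Data.Nat.ListAction using (sum)
open import Data.Nat.Properties using (+-identityʳ; suc-injective)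
open import Data.Product as Product using (Σ; ∃; _×_; _,_; proj₁; proj₂)
open import Data.Product.Function.NonDependent.Propositional using (_×-↔_)
open import Data.Product.Properties using (Σ-≡,≡→≡; Σ-≡,≡←≡)
open import Data.Unit using (⊤; tt)
open import Data.Vec as Vec using (Vec; []; _∷_; replicate; _++_)
import Data.Vec.Properties as Vecₚ
open import Function using (_∘_)
open import Function.Bundles using (_⤖_; _↔_; mk↔ₛ′; Inverse)
open import Function.Properties.Inverse using (↔⇒⤖; ↔-sym; ↔-trans)
open import Function.Related.Propositional using (module EquationalReasoning)
open import Relation.Binary.PropositionalEquality
open import Relation.Unary using (Irrelevant)

private
  variable
    A B C : Set
    m : ℕ

Σ-≡-by-proj₁ : {P : A → Set} → Irrelevant P →
               {x y : Σ A P} → proj₁ x ≡ proj₁ y → x ≡ y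
Σ-≡-by-proj₁ irrelevant {a , p} {.a , q} refl = cong (a ,_) (irrelevant p q)

fibre↔ : {I : Set} {P : I → Set} (f : A ↔ Σ I P) {i : I} →
         Σ A (λ a → proj₁ (Inverse.to f a) ≡ i) ↔ P i
fibre↔ {A = A} {P = P} f {i} = mk↔ₛ′ restrict extend restrict-extend extend-restrict
  where
  open Inverse f
  restrict : Σ A (λ a → proj₁ (to a) ≡ i) → P i
  restrict (a , e) = subst P e (proj₂ (to a))
  extend : P i → Σ A (λ a → proj₁ (to a) ≡ i)
  extend b = from (i , b) , proj₁ (Σ-≡,≡←≡ (strictlyInverseˡ (i , b)))
  restrict-extend : ∀ b → restrict (extend b) ≡ b
  restrict-extend b = proj₂ (Σ-≡,≡←≡ (strictlyInverseˡ (i , b)))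
  extend-restrict : ∀ x → extend (restrict x) ≡ x
  extend-restrict (a , e) = Σ-≡-by-proj₁ uip
    (trans (cong from (sym (Σ-≡,≡→≡ (e , refl)))) (strictlyInverseʳ a))

map-↔ : A ↔ B → Vec A m ↔ Vec B m
map-↔ f = mk↔ₛ′ (Vec.map to) (Vec.map from)
                (map-inverse strictlyInverseˡ) (map-inverse strictlyInverseʳ)
  where
  open Inverse f
  map-inverse : ∀ {X Y} {g : X → Y} {h : Y → X} → (∀ y → g (h y) ≡ y) →
                ∀ ys → Vec.map g (Vec.map h ys) ≡ ys
  map-inverse {g = g} {h} gh ys =
    trans (sym (Vecₚ.map-∘ g h ys)) (trans (Vecₚ.map-cong gh ys) (Vecₚ.map-id ys))

-- The parts of a positive composition, each k standing for the part k + 1,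
-- all but the last coloured from C; the weight is the total minus one.
data Parts (C : Set) : Set where
  [_]    : ℕ → Parts C
  _∷⟨_⟩_ : ℕ → C → Parts C → Parts C

weight : Parts C → ℕ
weight [ k ]          = k
weight (k ∷⟨ c ⟩ ps) = k + suc (weight ps)

PartsOfWeight : Set → ℕ → Set
PartsOfWeight C m = Σ (Parts C) (λ ps → weight ps ≡ m)

toWord : (ps : Parts C) → Vec (Maybe C) (weight ps)
toWord [ k ]          = replicate k nothing
toWord (k ∷⟨ c ⟩ ps) = replicate k nothing ++ just c ∷ toWord ps

encode : Parts C → ∃ (Vec (Maybe C))
encode ps = weight ps , toWord ps

growFirst : Parts C → Parts C
growFirst [ k ]          = [ suc k ]
growFirst (k ∷⟨ c ⟩ ps) = suc k ∷⟨ c ⟩ ps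

fromWord : Vec (Maybe C) m → Parts C
fromWord []            = [ 0 ]
fromWord (nothing ∷ w) = growFirst (fromWord w)
fromWord (just c ∷ w)  = 0 ∷⟨ c ⟩ fromWord w

fromWord-toWord : (ps : Parts C) → fromWord (toWord ps) ≡ ps
fromWord-toWord [ zero ]           = refl
fromWord-toWord [ suc k ]          = cong growFirst (fromWord-toWord [ k ])
fromWord-toWord (zero ∷⟨ c ⟩ ps)  = cong (0 ∷⟨ c ⟩_) (fromWord-toWord ps)
fromWord-toWord (suc k ∷⟨ c ⟩ ps) = cong growFirst (fromWord-toWord (k ∷⟨ c ⟩ ps))

encode-growFirst : (ps : Parts C) →
                   encode (growFirst ps) ≡ Product.map suc (nothing ∷_) (encode ps)
encode-growFirst [ k ]          = refl
encode-growFirst (k ∷⟨ c ⟩ ps) = refl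

encode-fromWord : (w : Vec (Maybe C) m) → encode (fromWord w) ≡ (m , w)
encode-fromWord []            = refl
encode-fromWord (nothing ∷ w) =
  trans (encode-growFirst (fromWord w)) (cong (Product.map suc (nothing ∷_)) (encode-fromWord w))
encode-fromWord (just c ∷ w)  = cong (Product.map suc (just c ∷_)) (encode-fromWord w)

Parts↔∃Word : Parts C ↔ ∃ (Vec (Maybe C))
Parts↔∃Word = mk↔ₛ′ encode (fromWord ∘ proj₂) (encode-fromWord ∘ proj₂) fromWord-toWord

PartsOfWeight↔Word : PartsOfWeight C m ↔ Vec (Maybe C) m
PartsOfWeight↔Word = fibre↔ Parts↔∃Word

sizes : Parts C → List⁺ ℕ
sizes [ k ]          = k ∷ []
sizes (k ∷⟨ _ ⟩ ps) = k ∷⁺ sizes ps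

-- List⁺.foldr applies its second argument to the last element only.
fromSizes : List⁺ ℕ → Parts ⊤
fromSizes = List⁺.foldr (_∷⟨ tt ⟩_) [_]

fromSizes-sizes : (ps : Parts ⊤) → fromSizes (sizes ps) ≡ ps
fromSizes-sizes [ k ]          = refl
fromSizes-sizes (k ∷⟨ _ ⟩ ps) = cong (k ∷⟨ tt ⟩_) (fromSizes-sizes ps)

sizes-fromSizes : ∀ k ks → sizes (fromSizes (k ∷ ks)) ≡ k ∷ ks
sizes-fromSizes k []        = refl
sizes-fromSizes k (k′ ∷ ks) = cong (k ∷⁺_) (sizes-fromSizes k′ ks)

sum-sizes : (ps : Parts C) → sum (map suc (toList (sizes ps))) ≡ suc (weight ps)
sum-sizes [ k ]          = +-identityʳ (suc k)
sum-sizes (k ∷⟨ _ ⟩ ps) = cong (suc k +_) (sum-sizes ps)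

suc-weight-fromSizes : ∀ k ks →
                       suc (weight (fromSizes (k ∷ ks))) ≡ sum (map suc (k ∷ ks))
suc-weight-fromSizes k []        = cong suc (sym (+-identityʳ k))
suc-weight-fromSizes k (k′ ∷ ks) = cong (suc k +_) (suc-weight-fromSizes k′ ks)

Composition↔PartsOfWeight : Composition (suc m) ↔ PartsOfWeight ⊤ m
Composition↔PartsOfWeight {m} = mk↔ₛ′ to from to-from from-to
  where
  to : Composition (suc m) → PartsOfWeight ⊤ m
  to ([] , ())
  to (k ∷ ks , e) = fromSizes (k ∷ ks) , suc-injective (trans (suc-weight-fromSizes k ks) e)
  from : PartsOfWeight ⊤ m → Composition (suc m)
  from (ps , e) = toList (sizes ps) , trans (sum-sizes ps) (cong suc e)
  to-from : ∀ x → to (from x) ≡ x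
  to-from (ps , _) = Σ-≡-by-proj₁ uip (fromSizes-sizes ps)
  from-to : ∀ x → from (to x) ≡ x
  from-to ([] , ())
  from-to (k ∷ ks , _) = Σ-≡-by-proj₁ uip (cong toList (sizes-fromSizes k ks))

totalSize : List (ℕ × C) → ℕ
totalSize ps = sum (map (suc ∘ proj₁) ps)

colouredSizes : C → Parts C → List⁺ (ℕ × C)
colouredSizes c₀ [ k ]          = (k , c₀) ∷ []
colouredSizes c₀ (k ∷⟨ c ⟩ ps) = (k , c) ∷⁺ colouredSizes c₀ ps

fromColouredSizes : List⁺ (ℕ × C) → Parts C
fromColouredSizes = List⁺.foldr (λ (k , c) ps → k ∷⟨ c ⟩ ps) (λ (k , _) → [ k ])

fromColouredSizes-colouredSizes : (c₀ : C) (ps : Parts C) →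
                                  fromColouredSizes (colouredSizes c₀ ps) ≡ ps
fromColouredSizes-colouredSizes c₀ [ k ]          = refl
fromColouredSizes-colouredSizes c₀ (k ∷⟨ c ⟩ ps) =
  cong (k ∷⟨ c ⟩_) (fromColouredSizes-colouredSizes c₀ ps)

totalSize-colouredSizes : (c₀ : C) (ps : Parts C) →
                          totalSize (toList (colouredSizes c₀ ps)) ≡ suc (weight ps)
totalSize-colouredSizes c₀ [ k ]          = +-identityʳ (suc k)
totalSize-colouredSizes c₀ (k ∷⟨ _ ⟩ ps) = cong (suc k +_) (totalSize-colouredSizes c₀ ps)

suc-weight-fromColouredSizes : ∀ (p : ℕ × C) ps →
                               suc (weight (fromColouredSizes (p ∷ ps))) ≡ totalSize (p ∷ ps)
suc-weight-fromColouredSizes (k , _) []       = cong suc (sym (+-identityʳ k))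
suc-weight-fromColouredSizes (k , _) (q ∷ ps) =
  cong (suc k +_) (suc-weight-fromColouredSizes q ps)

colouredSizes-fromColouredSizes : ∀ {p ps} → LastColourOne (p ∷ ps) →
                                  colouredSizes zero (fromColouredSizes (p ∷ ps)) ≡ p ∷ ps
colouredSizes-fromColouredSizes (last-one k)         = refl
colouredSizes-fromColouredSizes (last-cons p q ps l) =
  cong (p ∷⁺_) (colouredSizes-fromColouredSizes l)

lastColourOne-colouredSizes : (ps : Parts (Fin 3)) →
                              LastColourOne (toList (colouredSizes zero ps))
lastColourOne-colouredSizes [ k ]          = last-one k
lastColourOne-colouredSizes (k ∷⟨ c ⟩ ps) = last-cons _ _ _ (lastColourOne-colouredSizes ps)

LastColourOne-irrelevant : Irrelevant LastColourOne
LastColourOne-irrelevant last-[]              last-[]               = refl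
LastColourOne-irrelevant (last-one k)         (last-one k)          = refl
LastColourOne-irrelevant (last-cons p q ps l) (last-cons p q ps l′) =
  cong (last-cons p q ps) (LastColourOne-irrelevant l l′)

ThreeComposition↔PartsOfWeight : ThreeComposition (suc m) ↔ PartsOfWeight (Fin 3) m
ThreeComposition↔PartsOfWeight {m} = mk↔ₛ′ to from to-from from-to
  where
  to : ThreeComposition (suc m) → PartsOfWeight (Fin 3) m
  to ([] , () , _)
  to (p ∷ ps , e , _) =
    fromColouredSizes (p ∷ ps) , suc-injective (trans (suc-weight-fromColouredSizes p ps) e)
  from : PartsOfWeight (Fin 3) m → ThreeComposition (suc m)
  from (ps , e) = toList (colouredSizes zero ps) ,
                  trans (totalSize-colouredSizes zero ps) (cong suc e) ,
                  lastColourOne-colouredSizes ps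
  to-from : ∀ x → to (from x) ≡ x
  to-from (ps , _) = Σ-≡-by-proj₁ uip (fromColouredSizes-colouredSizes zero ps)
  from-to : ∀ x → from (to x) ≡ x
  from-to ([] , () , _)
  from-to (p ∷ ps , _ , l) =
    Σ-≡-by-proj₁ (λ (e , l) (e′ , l′) → cong₂ _,_ (uip e e′) (LastColourOne-irrelevant l l′))
                 (cong toList (colouredSizes-fromColouredSizes l))

Composition↔Word : Composition (suc m) ↔ Vec (Maybe ⊤) m
Composition↔Word = ↔-trans Composition↔PartsOfWeight PartsOfWeight↔Word

ThreeComposition↔Word : ThreeComposition (suc m) ↔ Vec (Maybe (Fin 3)) m
ThreeComposition↔Word = ↔-trans ThreeComposition↔PartsOfWeight PartsOfWeight↔Word

Letter↔Cut² : Maybe (Fin 3) ↔ (Maybe ⊤ × Maybe ⊤)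
Letter↔Cut² = mk↔ₛ′ split join split-join join-split
  where
  split : Maybe (Fin 3) → Maybe ⊤ × Maybe ⊤
  split nothing                 = nothing , nothing
  split (just zero)             = just tt , just tt
  split (just (suc zero))       = just tt , nothing
  split (just (suc (suc zero))) = nothing , just tt
  join : Maybe ⊤ × Maybe ⊤ → Maybe (Fin 3)
  join (nothing , nothing) = nothing
  join (just _  , just _)  = just zero
  join (just _  , nothing) = just (suc zero)
  join (nothing , just _)  = just (suc (suc zero))
  split-join : ∀ x → split (join x) ≡ x
  split-join (nothing , nothing) = refl
  split-join (just _  , just _)  = refl
  split-join (just _  , nothing) = refl
  split-join (nothing , just _)  = refl
  join-split : ∀ x → join (split x) ≡ x
  join-split nothing                 = refl
  join-split (just zero)             = refl
  join-split (just (suc zero))       = refl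
  join-split (just (suc (suc zero))) = refl

proposition2p2 : (n : ℕ) → n ≥ 1 → ThreeComposition n ⤖ (Composition n × Composition n)
proposition2p2 (suc m) _ = ↔⇒⤖ (begin
  ThreeComposition (suc m)                     ↔⟨ ThreeComposition↔Word ⟩
  Vec (Maybe (Fin 3)) m                        ↔⟨ map-↔ Letter↔Cut² ⟩
  Vec (Maybe ⊤ × Maybe ⊤) m                    ↔⟨ ↔-sym Vecₚ.×v↔v× ⟩
  (Vec (Maybe ⊤) m × Vec (Maybe ⊤) m)
    ↔⟨ ↔-sym Composition↔Word ×-↔ ↔-sym Composition↔Word ⟩
  (Composition (suc m) × Composition (suc m))  ∎)
  where open EquationalReasoning
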